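{- Let $\mathfrak X$ be a homogeneous tree of degree $q+1$ ($q\geq1$), let $k,\ell$ be integers with $2\leq k<\ell$, and let $\{f_j\}_{j\in\mathbb Z}$ be a wave on $\mathfrak X$. Then for any integers $r$ and $s$, $$f_{rk+s\ell}=T_{s\ell}(\mu_1)f_{rk}+T_{rk}(\mu_1)f_{s\ell}-T_{rk-s\ell}(\mu_1)f_0.$$
   Context: $\mathfrak X$ is a tree in which every vertex has exactly $q+1$ edges; $\mathcal F(\mathfrak X)$ is the space of complex-valued functions on its vertices; $\mu_1f(v)=\frac{1}{q+1}\sum_{w\text{ adjacent to }v}f(w)$. A wave is a family $\{f_j\}_{j\in\mathbb Z}$ in $\mathcal F(\mathfrak X)$ with $\mu_1f_j=\frac{f_{j+1}+f_{j-1}}{2}$ for all $j$. $T_m$: Chebyshev polynomials of the first kind, $T_0=1$, $T_1(x)=x$, $T_{m+1}=2xT_m-T_{m-1}$, $T_{ -m}=T_m$; polynomials are applied to the operator $\mu_1$. -}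

module Defs where

open import Level using (Level)
open import Algebra.Bundles using (CommutativeRing)
open import Data.Nat as ℕ using (ℕ; zero; suc)
open import Data.Integer as ℤ using (ℤ)
open import Data.Fin as Fin using (Fin)
open import Data.List using (List; []; _∷_)
open import Data.List.Relation.Unary.Linked as Linked using (Linked; []; [-]; _∷_)
open import Data.Product using (Σ; _,_; proj₁)
open import Relation.Binary.PropositionalEquality using (_≡_; _≢_)
open import Relation.Nullary using (yes; no)

-- The homogeneous tree 𝔛 of degree q+1, realised concretely as the
-- Cayley graph of the free product of q+1 copies of ℤ/2:
-- vertices are reduced words over the alphabet Fin (suc q), i.e. lists
-- with no two consecutive equal letters (stored with the LAST letter at
-- the head).  The neighbours of w are w·a for a : Fin (suc q), where
-- w·a deletes the last letter if it equals a and appends a otherwise.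
-- Every vertex has exactly q+1 (distinct) neighbours, and the graph is a tree.

Vertex : ℕ → Set
Vertex q = Σ (List (Fin (suc q))) (Linked _≢_)

private
  step : ∀ {q} (a : Fin (suc q)) (w : List (Fin (suc q))) → Linked _≢_ w → Vertex q
  step a [] _ = a ∷ [] , [-]
  step a (b ∷ w) lw with a Fin.≟ b
  ... | yes _ = w , Linked.tail lw
  ... | no a≢b = a ∷ b ∷ w , a≢b ∷ lw

nb : ∀ {q} → Vertex q → Fin (suc q) → Vertex q
nb (w , lw) a = step a w lw

-- Scalars: an arbitrary commutative ring R (ℂ in the paper) together with
-- an inverse of (q+1)·1, needed to define μ₁.

module Wave {c ℓ : Level} (R : CommutativeRing c ℓ) (q : ℕ) where
  open CommutativeRing R

  nat : ℕ → Carrier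
  nat zero = 0#
  nat (suc n) = 1# + nat n

  sumFin : ∀ {n} → (Fin n → Carrier) → Carrier
  sumFin {zero} g = 0#
  sumFin {suc n} g = g Fin.zero + sumFin (λ i → g (Fin.suc i))

  𝓕 : Set c
  𝓕 = Vertex q → Carrier

  _≋_ : 𝓕 → 𝓕 → Set ℓ
  f ≋ g = ∀ v → f v ≈ g v

  module _ (inv : Carrier) where
    μ₁ : 𝓕 → 𝓕
    μ₁ f v = inv * sumFin (λ a → f (nb v a))

    -- Chebyshev polynomial T_m applied to the operator μ₁ (m ≥ 0):
    -- T₀ = 1, T₁ = x, T_{m+2} = 2x T_{m+1} − T_m
    Tℕ : ℕ → 𝓕 → 𝓕
    Tℕ zero f = f
    Tℕ (suc zero) f = μ₁ f
    Tℕ (suc (suc m)) f v =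
      (μ₁ (Tℕ (suc m) f) v + μ₁ (Tℕ (suc m) f) v) - Tℕ m f v

    T : ℤ → 𝓕 → 𝓕
    T m = Tℕ ℤ.∣ m ∣

    -- a wave: μ₁ f_j = (f_{j+1} + f_{j-1}) / 2, written as 2 μ₁ f_j = f_{j+1} + f_{j-1}
    IsWave : (ℤ → 𝓕) → Set ℓ
    IsWave f = ∀ (j : ℤ) (v : Vertex q) →
      μ₁ (f j) v + μ₁ (f j) v ≈ f (j ℤ.+ ℤ.+ 1) v + f (j ℤ.- ℤ.+ 1) v

{-# OPTIONS --safe #-}
-- For a wave f and fixed a, the defect
--   D(a, b) = f_{a+b} − ((T_b f_a + T_a f_b) − T_{a−b} f_0)
-- is again a wave in b: waves are closed under shifts j ↦ a + j, reflections j ↦ a − j,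
-- sums, negatives and the operators T_m (which are additive and commute with μ₁), and
-- j ↦ T_j g is a wave by the Chebyshev recurrence.  A wave vanishing at 0 and 1 vanishes
-- identically.  Now D(a, 0) = 0, and D(a, 1) = D(1, a) = 0 because D(1, ·) is a wave with
-- D(1, 0) = 0 and D(1, 1) = 0, the latter being the wave equation at 1.
module Submission where

open import Defs
open import Level using (Level)
open import Algebra.Bundles using (CommutativeRing)
open import Data.Nat as ℕ using (ℕ; zero; suc)
import Data.Nat.Properties as ℕ
open import Data.Integer as ℤ using (ℤ; +_; -[1+_])
import Data.Integer.Properties as ℤ
open import Data.Integer.Tactic.RingSolver using (solve-∀)
open import Data.Fin as Fin using (Fin)
open import Data.Product using (_×_; _,_; proj₁)
open import Relation.Binary.PropositionalEquality as ≡ using (_≡_)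

i-[j+1]≡i-j-1 : ∀ i j → i ℤ.- (j ℤ.+ + 1) ≡ i ℤ.- j ℤ.- + 1
i-[j+1]≡i-j-1 = solve-∀

i-[j-1]≡i-j+1 : ∀ i j → i ℤ.- (j ℤ.- + 1) ≡ i ℤ.- j ℤ.+ + 1
i-[j-1]≡i-j+1 = solve-∀

∣-[1+n]+1∣≡n : ∀ n → ℤ.∣ -[1+ n ] ℤ.+ + 1 ∣ ≡ n
∣-[1+n]+1∣≡n zero    = ≡.refl
∣-[1+n]+1∣≡n (suc n) = ≡.refl

module Waves {c ℓ : Level} (R : CommutativeRing c ℓ) (q : ℕ) (inv : CommutativeRing.Carrier R) where
  open CommutativeRing R hiding (zero)
  open Wave R q
  open import Algebra.Properties.Ring ring using (-‿distribʳ-*)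
  open import Algebra.Properties.AbelianGroup +-abelianGroup
    using (ε⁻¹≈ε; ⁻¹-∙-comm; x≈y⇒x∙y⁻¹≈ε; x∙y⁻¹≈ε⇒x≈y; //-rightDividesˡ; //-rightDividesʳ)
  open import Algebra.Properties.CommutativeSemigroup +-commutativeSemigroup using (interchange)
  open import Relation.Binary.Reasoning.Setoid setoid

  infixl 26 _+ᶠ_ _-ᶠ_
  infix 27 -ᶠ_

  _+ᶠ_ : 𝓕 → 𝓕 → 𝓕
  (f +ᶠ g) v = f v + g v

  -ᶠ_ : 𝓕 → 𝓕
  (-ᶠ f) v = - f v

  _-ᶠ_ : 𝓕 → 𝓕 → 𝓕
  f -ᶠ g = f +ᶠ -ᶠ g

  0ᶠ : 𝓕
  0ᶠ _ = 0#

  cong-≋ : ∀ {a} {A : Set a} (F : A → 𝓕) {x y : A} → x ≡ y → F x ≋ F y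
  cong-≋ F ≡.refl _ = refl

  -‿interchange : ∀ x y z w → (x + y) - (z + w) ≈ (x - z) + (y - w)
  -‿interchange x y z w = trans (+-congˡ (sym (⁻¹-∙-comm z w))) (interchange x y (- z) (- w))

  sumFin-cong : ∀ {n} {g h : Fin n → Carrier} → (∀ i → g i ≈ h i) → sumFin g ≈ sumFin h
  sumFin-cong {zero}  _   = refl
  sumFin-cong {suc n} g≈h = +-cong (g≈h Fin.zero) (sumFin-cong (λ i → g≈h (Fin.suc i)))

  sumFin-+ : ∀ {n} (g h : Fin n → Carrier) → sumFin (λ i → g i + h i) ≈ sumFin g + sumFin h
  sumFin-+ {zero}  _ _ = sym (+-identityˡ 0#)
  sumFin-+ {suc n} g h =
    trans (+-congˡ (sumFin-+ (λ i → g (Fin.suc i)) (λ i → h (Fin.suc i)))) (interchange _ _ _ _)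

  sumFin-neg : ∀ {n} (g : Fin n → Carrier) → sumFin (λ i → - g i) ≈ - sumFin g
  sumFin-neg {zero}  _ = sym ε⁻¹≈ε
  sumFin-neg {suc n} g = trans (+-congˡ (sumFin-neg (λ i → g (Fin.suc i)))) (⁻¹-∙-comm _ _)

  sumFin-zero : ∀ {n} → sumFin {n} (λ _ → 0#) ≈ 0#
  sumFin-zero {zero}  = refl
  sumFin-zero {suc n} = trans (+-congˡ (sumFin-zero {n})) (+-identityˡ 0#)

  μ₁-cong : ∀ {f g} → f ≋ g → μ₁ inv f ≋ μ₁ inv g
  μ₁-cong f≋g v = *-congˡ (sumFin-cong (λ a → f≋g (nb v a)))

  μ₁-+ : ∀ f g → μ₁ inv (f +ᶠ g) ≋ μ₁ inv f +ᶠ μ₁ inv g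
  μ₁-+ f g v = trans (*-congˡ (sumFin-+ (λ a → f (nb v a)) (λ a → g (nb v a)))) (distribˡ inv _ _)

  μ₁-neg : ∀ f → μ₁ inv (-ᶠ f) ≋ -ᶠ μ₁ inv f
  μ₁-neg f v = trans (*-congˡ (sumFin-neg (λ a → f (nb v a)))) (sym (-‿distribʳ-* inv _))

  μ₁-- : ∀ f g → μ₁ inv (f -ᶠ g) ≋ μ₁ inv f -ᶠ μ₁ inv g
  μ₁-- f g v = trans (μ₁-+ f (-ᶠ g) v) (+-congˡ (μ₁-neg g v))

  μ₁-zero : ∀ {f} → f ≋ 0ᶠ → μ₁ inv f ≋ 0ᶠ
  μ₁-zero f≋0 v =
    trans (*-congˡ (trans (sumFin-cong (λ a → f≋0 (nb v a))) (sumFin-zero {suc q}))) (zeroʳ inv)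

  -- Tℕ inv (suc (suc m)) f unfolds to chebyshev-step (Tℕ inv (suc m) f) (Tℕ inv m f).
  chebyshev-step : 𝓕 → 𝓕 → 𝓕
  chebyshev-step x y = (μ₁ inv x +ᶠ μ₁ inv x) -ᶠ y

  chebyshev-step-cong : ∀ {x x′ y y′} → x ≋ x′ → y ≋ y′ → chebyshev-step x y ≋ chebyshev-step x′ y′
  chebyshev-step-cong x≋x′ y≋y′ v = +-cong (+-cong (μ₁-cong x≋x′ v) (μ₁-cong x≋x′ v)) (-‿cong (y≋y′ v))

  chebyshev-step-+ : ∀ x x′ y y′ →
    chebyshev-step (x +ᶠ x′) (y +ᶠ y′) ≋ chebyshev-step x y +ᶠ chebyshev-step x′ y′
  chebyshev-step-+ x x′ y y′ v = begin
    (μ₁ inv (x +ᶠ x′) v + μ₁ inv (x +ᶠ x′) v) - (y v + y′ v)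
      ≈⟨ +-congʳ (+-cong (μ₁-+ x x′ v) (μ₁-+ x x′ v)) ⟩
    ((μx + μx′) + (μx + μx′)) - (y v + y′ v)  ≈⟨ +-congʳ (interchange μx μx′ μx μx′) ⟩
    ((μx + μx) + (μx′ + μx′)) - (y v + y′ v)  ≈⟨ -‿interchange _ _ _ _ ⟩
    ((μx + μx) - y v) + ((μx′ + μx′) - y′ v)  ∎
    where
    μx μx′ : Carrier
    μx = μ₁ inv x v
    μx′ = μ₁ inv x′ v

  chebyshev-step-μ₁ : ∀ x y → chebyshev-step (μ₁ inv x) (μ₁ inv y) ≋ μ₁ inv (chebyshev-step x y)
  chebyshev-step-μ₁ x y v =
    sym (trans (μ₁-- (μ₁ inv x +ᶠ μ₁ inv x) y v) (+-congʳ (μ₁-+ (μ₁ inv x) (μ₁ inv x) v)))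

  Tℕ-cong : ∀ m {f g} → f ≋ g → Tℕ inv m f ≋ Tℕ inv m g
  Tℕ-cong zero          f≋g = f≋g
  Tℕ-cong (suc zero)    f≋g = μ₁-cong f≋g
  Tℕ-cong (suc (suc m)) f≋g = chebyshev-step-cong (Tℕ-cong (suc m) f≋g) (Tℕ-cong m f≋g)

  Tℕ-+ : ∀ m f g → Tℕ inv m (f +ᶠ g) ≋ Tℕ inv m f +ᶠ Tℕ inv m g
  Tℕ-+ zero          f g v = refl
  Tℕ-+ (suc zero)    f g   = μ₁-+ f g
  Tℕ-+ (suc (suc m)) f g v = trans (chebyshev-step-cong (Tℕ-+ (suc m) f g) (Tℕ-+ m f g) v)
    (chebyshev-step-+ (Tℕ inv (suc m) f) (Tℕ inv (suc m) g) (Tℕ inv m f) (Tℕ inv m g) v)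

  Tℕ-μ₁-comm : ∀ m f → Tℕ inv m (μ₁ inv f) ≋ μ₁ inv (Tℕ inv m f)
  Tℕ-μ₁-comm zero          f v = refl
  Tℕ-μ₁-comm (suc zero)    f v = refl
  Tℕ-μ₁-comm (suc (suc m)) f v = trans (chebyshev-step-cong (Tℕ-μ₁-comm (suc m) f) (Tℕ-μ₁-comm m f) v)
    (chebyshev-step-μ₁ (Tℕ inv (suc m) f) (Tℕ inv m f) v)

  Tℕ-recurrence : ∀ m f →
    Tℕ inv (suc (suc m)) f +ᶠ Tℕ inv m f ≋ μ₁ inv (Tℕ inv (suc m) f) +ᶠ μ₁ inv (Tℕ inv (suc m) f)
  Tℕ-recurrence m f v = //-rightDividesˡ (Tℕ inv m f v) _

  +-wave : ∀ f g → IsWave inv f → IsWave inv g → IsWave inv (λ j → f j +ᶠ g j)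
  +-wave f g wf wg j v = begin
    μ₁ inv (f j +ᶠ g j) v + μ₁ inv (f j +ᶠ g j) v
      ≈⟨ +-cong (μ₁-+ (f j) (g j) v) (μ₁-+ (f j) (g j) v) ⟩
    (μ₁ inv (f j) v + μ₁ inv (g j) v) + (μ₁ inv (f j) v + μ₁ inv (g j) v)
      ≈⟨ interchange _ _ _ _ ⟩
    (μ₁ inv (f j) v + μ₁ inv (f j) v) + (μ₁ inv (g j) v + μ₁ inv (g j) v)
      ≈⟨ +-cong (wf j v) (wg j v) ⟩
    (f (j ℤ.+ + 1) v + f (j ℤ.- + 1) v) + (g (j ℤ.+ + 1) v + g (j ℤ.- + 1) v)
      ≈⟨ interchange _ _ _ _ ⟩
    (f (j ℤ.+ + 1) v + g (j ℤ.+ + 1) v) + (f (j ℤ.- + 1) v + g (j ℤ.- + 1) v) ∎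

  neg-wave : ∀ f → IsWave inv f → IsWave inv (λ j → -ᶠ f j)
  neg-wave f wf j v = begin
    μ₁ inv (-ᶠ f j) v + μ₁ inv (-ᶠ f j) v  ≈⟨ +-cong (μ₁-neg (f j) v) (μ₁-neg (f j) v) ⟩
    - μ₁ inv (f j) v + - μ₁ inv (f j) v    ≈⟨ ⁻¹-∙-comm _ _ ⟩
    - (μ₁ inv (f j) v + μ₁ inv (f j) v)    ≈⟨ -‿cong (wf j v) ⟩
    - (f (j ℤ.+ + 1) v + f (j ℤ.- + 1) v)  ≈⟨ ⁻¹-∙-comm _ _ ⟨
    - f (j ℤ.+ + 1) v + - f (j ℤ.- + 1) v  ∎

  sub-wave : ∀ f g → IsWave inv f → IsWave inv g → IsWave inv (λ j → f j -ᶠ g j)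
  sub-wave f g wf wg = +-wave f (λ j → -ᶠ g j) wf (neg-wave g wg)

  shift-wave : ∀ a f → IsWave inv f → IsWave inv (λ j → f (a ℤ.+ j))
  shift-wave a f wf j v = trans (wf (a ℤ.+ j) v)
    (+-cong (cong-≋ f (ℤ.+-assoc a j (+ 1)) v) (cong-≋ f (ℤ.+-assoc a j (ℤ.- + 1)) v))

  reflect-wave : ∀ a f → IsWave inv f → IsWave inv (λ j → f (a ℤ.- j))
  reflect-wave a f wf j v = trans (wf (a ℤ.- j) v) (trans (+-comm _ _)
    (+-cong (cong-≋ f (≡.sym (i-[j+1]≡i-j-1 a j)) v) (cong-≋ f (≡.sym (i-[j-1]≡i-j+1 a j)) v)))

  Tℕ-wave : ∀ m f → IsWave inv f → IsWave inv (λ j → Tℕ inv m (f j))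
  Tℕ-wave m f wf j v = begin
    μ₁ inv (Tₘ (f j)) v + μ₁ inv (Tₘ (f j)) v
      ≈⟨ +-cong (Tℕ-μ₁-comm m (f j) v) (Tℕ-μ₁-comm m (f j) v) ⟨
    Tₘ (μ₁ inv (f j)) v + Tₘ (μ₁ inv (f j)) v  ≈⟨ Tℕ-+ m (μ₁ inv (f j)) (μ₁ inv (f j)) v ⟨
    Tₘ (μ₁ inv (f j) +ᶠ μ₁ inv (f j)) v       ≈⟨ Tℕ-cong m (wf j) v ⟩
    Tₘ (f (j ℤ.+ + 1) +ᶠ f (j ℤ.- + 1)) v     ≈⟨ Tℕ-+ m (f (j ℤ.+ + 1)) (f (j ℤ.- + 1)) v ⟩
    Tₘ (f (j ℤ.+ + 1)) v + Tₘ (f (j ℤ.- + 1)) v ∎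
    where
    Tₘ : 𝓕 → 𝓕
    Tₘ = Tℕ inv m

  chebyshev-wave : ∀ g → IsWave inv (λ j → T inv j g)
  chebyshev-wave g (+ zero)   v = refl
  chebyshev-wave g (+ suc n)  v = trans (sym (Tℕ-recurrence n g v))
    (+-congʳ (cong-≋ (λ m → Tℕ inv m g) (≡.cong suc (ℕ.+-comm 1 n)) v))
  chebyshev-wave g -[1+ n ] v = trans (sym (Tℕ-recurrence n g v)) (trans (+-comm _ _)
    (+-cong (cong-≋ (λ m → Tℕ inv m g) (≡.sym (∣-[1+n]+1∣≡n n)) v)
            (cong-≋ (λ m → Tℕ inv m g) (≡.cong (λ m → suc (suc m)) (≡.sym (ℕ.+-identityʳ n))) v)))

  wave-vanishes-ℕ : ∀ {u} → IsWave inv u → u (+ 0) ≋ 0ᶠ → u (+ 1) ≋ 0ᶠ → ∀ n → u (+ n) ≋ 0ᶠ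
  wave-vanishes-ℕ {u} wu u₀ u₁ n = proj₁ (consecutive n)
    where
    next : ∀ {n} → u (+ n) ≋ 0ᶠ → u (+ suc n) ≋ 0ᶠ → u (+ suc (suc n)) ≋ 0ᶠ
    next {n} uₙ uₙ₊₁ v = begin
      u (+ suc (suc n)) v                     ≈⟨ +-identityʳ _ ⟨
      u (+ suc (suc n)) v + 0#                ≈⟨ +-congˡ (uₙ v) ⟨
      u (+ suc (suc n)) v + u (+ n) v         ≈⟨ +-congʳ (cong-≋ u (≡.cong +_ (ℕ.+-comm (suc n) 1)) v) ⟨
      u (+ suc n ℤ.+ + 1) v + u (+ n) v       ≈⟨ wu (+ suc n) v ⟨
      μ₁ inv (u (+ suc n)) v + μ₁ inv (u (+ suc n)) v
        ≈⟨ +-cong (μ₁-zero uₙ₊₁ v) (μ₁-zero uₙ₊₁ v) ⟩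
      0# + 0#                                 ≈⟨ +-identityʳ 0# ⟩
      0#                                      ∎

    consecutive : ∀ n → u (+ n) ≋ 0ᶠ × u (+ suc n) ≋ 0ᶠ
    consecutive zero    = u₀ , u₁
    consecutive (suc n) = let (uₙ , uₙ₊₁) = consecutive n in uₙ₊₁ , next uₙ uₙ₊₁

  -- Reflecting in 1 swaps the values at 0 and 1 and sends + (n + 2) to -[1+ n ].
  wave-vanishes : ∀ {u} → IsWave inv u → u (+ 0) ≋ 0ᶠ → u (+ 1) ≋ 0ᶠ → ∀ j → u j ≋ 0ᶠ
  wave-vanishes {u} wu u₀ u₁ (+ n)    = wave-vanishes-ℕ {u} wu u₀ u₁ n
  wave-vanishes {u} wu u₀ u₁ -[1+ n ] =
    wave-vanishes-ℕ {λ j → u (+ 1 ℤ.- j)} (reflect-wave (+ 1) u wu) u₁ u₀ (suc (suc n))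

  module AdditionFormula (f : ℤ → 𝓕) (wf : IsWave inv f) where

    combination : ℤ → ℤ → 𝓕
    combination a b = (T inv b (f a) +ᶠ T inv a (f b)) -ᶠ T inv (a ℤ.- b) (f (+ 0))

    defect : ℤ → ℤ → 𝓕
    defect a b = f (a ℤ.+ b) -ᶠ combination a b

    combination-wave : ∀ a → IsWave inv (combination a)
    combination-wave a = sub-wave (λ b → T inv b (f a) +ᶠ T inv a (f b)) (λ b → T inv (a ℤ.- b) (f (+ 0)))
      (+-wave (λ b → T inv b (f a)) (λ b → T inv a (f b)) (chebyshev-wave (f a)) (Tℕ-wave ℤ.∣ a ∣ f wf))
      (reflect-wave a (λ b → T inv b (f (+ 0))) (chebyshev-wave (f (+ 0))))

    defect-wave : ∀ a → IsWave inv (defect a)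
    defect-wave a = sub-wave (λ b → f (a ℤ.+ b)) (combination a) (shift-wave a f wf) (combination-wave a)

    defect-zeroʳ : ∀ a → defect a (+ 0) ≋ 0ᶠ
    defect-zeroʳ a v = x≈y⇒x∙y⁻¹≈ε (begin
      f (a ℤ.+ + 0) v                                   ≈⟨ cong-≋ f (ℤ.+-identityʳ a) v ⟩
      f a v                                             ≈⟨ //-rightDividesʳ (T inv a (f (+ 0)) v) _ ⟨
      (f a v + T inv a (f (+ 0)) v) - T inv a (f (+ 0)) v
        ≈⟨ +-congˡ (-‿cong (cong-≋ (λ i → T inv i (f (+ 0))) (ℤ.+-identityʳ a) v)) ⟨
      (f a v + T inv a (f (+ 0)) v) - T inv (a ℤ.- + 0) (f (+ 0)) v ∎)

    defect-comm : ∀ a b → defect a b ≋ defect b a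
    defect-comm a b v = +-cong (cong-≋ f (ℤ.+-comm a b) v) (-‿cong (+-cong (+-comm _ _)
      (-‿cong (cong-≋ (λ m → Tℕ inv m (f (+ 0))) (ℤ.∣i-j∣≡∣j-i∣ a b) v))))

    defect-one-one : defect (+ 1) (+ 1) ≋ 0ᶠ
    defect-one-one v = x≈y⇒x∙y⁻¹≈ε (sym (trans (+-congʳ (wf (+ 1) v)) (//-rightDividesʳ _ _)))

    defect-vanishes : ∀ a b → defect a b ≋ 0ᶠ
    defect-vanishes a = wave-vanishes (defect-wave a) (defect-zeroʳ a) defect-at-one
      where
      defect-at-one : defect a (+ 1) ≋ 0ᶠ
      defect-at-one v = trans (defect-comm a (+ 1) v)
        (wave-vanishes (defect-wave (+ 1)) (defect-zeroʳ (+ 1)) defect-one-one a v)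

    addition-formula : ∀ a b → f (a ℤ.+ b) ≋ combination a b
    addition-formula a b v = x∙y⁻¹≈ε⇒x≈y _ _ (defect-vanishes a b v)

open import Data.Integer using (_*_; _+_; _-_; _≤_; _<_)

lemma5p1 : ∀ {c ℓ : Level} (R : CommutativeRing c ℓ) (q : ℕ) → 1 ℕ.≤ q →
    (inv : CommutativeRing.Carrier R) →
    CommutativeRing._≈_ R (CommutativeRing._*_ R inv (Wave.nat R q (suc q))) (CommutativeRing.1# R) →
    (k l : ℤ) → ℤ.+ 2 ≤ k → k < l →
    (f : ℤ → Wave.𝓕 R q) → Wave.IsWave R q inv f →
    (r s : ℤ) →
    Wave._≋_ R q (f (r * k + s * l))
      (λ v → CommutativeRing._-_ R
        (CommutativeRing._+_ R (Wave.T R q inv (s * l) (f (r * k)) v) (Wave.T R q inv (r * k) (f (s * l)) v))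
        (Wave.T R q inv (r * k - s * l) (f (ℤ.+ 0)) v))
lemma5p1 R q _ inv _ k l _ _ f wave r s =
  Waves.AdditionFormula.addition-formula R q inv f wave (r * k) (s * l)
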